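{- Let $N\le M$ be positive integers and let $f_{NM}:S_c[X_N]\to S_c[X_M]$ be the semiring homomorphism described in the context. Then $f_{NM}$ is injective (a monomorphism).
   Context: A semiring is a set $S$ with operations $\circ$ and $\cdot$ such that $(S,\circ)$ is a commutative monoid with identity $\theta$, $(S,\cdot)$ is a monoid with identity $1$, $\cdot$ distributes over $\circ$ on both sides, $\theta\cdot s=s\cdot\theta=\theta$ for all $s$, and $1\neq\theta$. For a positive integer $N$, let $X_N=\{x_1,\dots,x_N\}$, $X_N^c=\{x_1^c,\dots,x_N^c\}$, let $Rig[X_N\cup X_N^c]$ be the free commutative semiring on $X_N\cup X_N^c$, and let $S_c[X_N]$ be its quotient by the congruence generated by the pairs $(x_i\cdot x_i^c,\theta)$, $(x_i\circ x_i^c,1)$, $(x_i\circ x_i,x_i)$, $(x_i^c\circ x_i^c,x_i^c)$, $1\le i\le N$. For $k=\sum_{l=1}^N j_l2^{l-1}$ with $j_l\in\{0,1\}$ put $y_k^{(N)}=x_1^{j_1}\cdots x_N^{j_N}\in S_c[X_N]$, where $x_l^{1}=x_l$ and $x_l^{0}=x_l^c$. It is known that every element of $S_c[X_N]$ can be written uniquely as $\sum^{\circ}_{k\in D}y_k^{(N)}$ with $D\subseteq\{0,1,\dots,2^N-1\}$ (the empty sum being $\theta$, and $D=\{0,\dots,2^N-1\}$ giving $1$). For $N\le M$, the inclusion $Rig[X_N\cup X_N^c]\to Rig[X_M\cup X_M^c]$ (sending $x_i\mapsto x_i$, $x_i^c\mapsto x_i^c$) induces a unique semiring homomorphism $f_{NM}:S_c[X_N]\to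 S_c[X_M]$ compatible with the quotient maps. -}

module Defs where

open import Data.Nat using (ℕ; _≤_)
open import Data.Fin using (Fin; inject≤)
open import Level using (0ℓ)
open import Relation.Binary.Bundles using (Setoid)
open import Relation.Binary.Structures using (IsEquivalence)

-- Generators X_N ∪ X_N^c : pos i = x_{i+1}, neg i = x_{i+1}^c
data Gen (N : ℕ) : Set where
  pos : Fin N → Gen N
  neg : Fin N → Gen N

infixl 6 _∘_
infixl 7 _·_
data Term (A : Set) : Set where
  var : A → Term A
  θ   : Term A
  one : Term A
  _∘_ : Term A → Term A → Term A
  _·_ : Term A → Term A → Term A

-- Term (Gen N) / _≈_ is S_c[X_N].
infix 4 _≈_
data _≈_ {N : ℕ} : Term (Gen N) → Term (Gen N) → Set where
  ≈-refl  : ∀ {s} → s ≈ s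
  ≈-sym   : ∀ {s t} → s ≈ t → t ≈ s
  ≈-trans : ∀ {s t u} → s ≈ t → t ≈ u → s ≈ u
  ∘-cong  : ∀ {s s' t t'} → s ≈ s' → t ≈ t' → s ∘ t ≈ s' ∘ t'
  ·-cong  : ∀ {s s' t t'} → s ≈ s' → t ≈ t' → s · t ≈ s' · t'
  ∘-assoc : ∀ s t u → (s ∘ t) ∘ u ≈ s ∘ (t ∘ u)
  ∘-comm  : ∀ s t → s ∘ t ≈ t ∘ s
  ∘-idˡ   : ∀ s → θ ∘ s ≈ s
  ·-assoc : ∀ s t u → (s · t) · u ≈ s · (t · u)
  ·-comm  : ∀ s t → s · t ≈ t · s
  ·-idˡ   : ∀ s → one · s ≈ s
  distribˡ : ∀ s t u → s · (t ∘ u) ≈ (s · t) ∘ (s · u)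
  zeroˡ   : ∀ s → θ · s ≈ θ
  compl-·  : ∀ i → var (pos i) · var (neg i) ≈ θ
  compl-∘  : ∀ i → var (pos i) ∘ var (neg i) ≈ one
  idem-pos : ∀ i → var (pos i) ∘ var (pos i) ≈ var (pos i)
  idem-neg : ∀ i → var (neg i) ∘ var (neg i) ≈ var (neg i)

≈-isEquivalence : ∀ {N} → IsEquivalence (_≈_ {N})
≈-isEquivalence = record { refl = ≈-refl ; sym = ≈-sym ; trans = ≈-trans }

S-c : ℕ → Setoid 0ℓ 0ℓ
S-c N = record { Carrier = Term (Gen N) ; _≈_ = _≈_ ; isEquivalence = ≈-isEquivalence }

map-term : ∀ {A B : Set} → (A → B) → Term A → Term B
map-term f (var a) = var (f a)
map-term f θ = θ
map-term f one = one
map-term f (s ∘ t) = map-term f s ∘ map-term f t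
map-term f (s · t) = map-term f s · map-term f t

inc-gen : ∀ {N M} → N ≤ M → Gen N → Gen M
inc-gen N≤M (pos i) = pos (inject≤ i N≤M)
inc-gen N≤M (neg i) = neg (inject≤ i N≤M)

-- The map f_NM on representatives (the inclusion Rig[X_N∪X_N^c] → Rig[X_M∪X_M^c]);
-- it descends to S_c[X_N] → S_c[X_M].
f : ∀ {N M} → N ≤ M → Term (Gen N) → Term (Gen M)
f N≤M = map-term (inc-gen N≤M)

{-# OPTIONS --safe #-}

-- Any map Fin N → Fin M renames generators compatibly with the defining
-- relations, so it induces a map S_c[X_N] → S_c[X_M].  Since N > 0, reduction
-- modulo N is a left inverse of the inclusion Fin N → Fin M; the map it
-- induces is therefore a left inverse of f_NM, which makes f_NM injective.

module Submission where

open import Defs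
open import Data.Nat using (ℕ; _≤_; _<_; NonZero; >-nonZero)
open import Data.Nat.DivMod using (_mod_; _%_; m<n⇒m%n≡m)
open import Data.Fin using (Fin; toℕ; inject≤)
open import Data.Fin.Properties using (toℕ-injective; toℕ-fromℕ<; toℕ-inject≤; toℕ<n)
open import Relation.Binary.PropositionalEquality
  using (_≡_; refl; cong; cong₂; subst₂; module ≡-Reasoning)

ren : ∀ {N M} → (Fin N → Fin M) → Gen N → Gen M
ren ρ (pos i) = pos (ρ i)
ren ρ (neg i) = neg (ρ i)

map-ren-resp-≈ : ∀ {N M} (ρ : Fin N → Fin M) {s t : Term (Gen N)} →
  s ≈ t → map-term (ren ρ) s ≈ map-term (ren ρ) t
map-ren-resp-≈ ρ ≈-refl            = ≈-refl
map-ren-resp-≈ ρ (≈-sym p)         = ≈-sym (map-ren-resp-≈ ρ p)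
map-ren-resp-≈ ρ (≈-trans p q)     = ≈-trans (map-ren-resp-≈ ρ p) (map-ren-resp-≈ ρ q)
map-ren-resp-≈ ρ (∘-cong p q)      = ∘-cong (map-ren-resp-≈ ρ p) (map-ren-resp-≈ ρ q)
map-ren-resp-≈ ρ (·-cong p q)      = ·-cong (map-ren-resp-≈ ρ p) (map-ren-resp-≈ ρ q)
map-ren-resp-≈ ρ (∘-assoc s t u)   = ∘-assoc _ _ _
map-ren-resp-≈ ρ (∘-comm s t)      = ∘-comm _ _
map-ren-resp-≈ ρ (∘-idˡ s)         = ∘-idˡ _
map-ren-resp-≈ ρ (·-assoc s t u)   = ·-assoc _ _ _
map-ren-resp-≈ ρ (·-comm s t)      = ·-comm _ _
map-ren-resp-≈ ρ (·-idˡ s)         = ·-idˡ _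
map-ren-resp-≈ ρ (distribˡ s t u)  = distribˡ _ _ _
map-ren-resp-≈ ρ (zeroˡ s)         = zeroˡ _
map-ren-resp-≈ ρ (compl-· i)       = compl-· (ρ i)
map-ren-resp-≈ ρ (compl-∘ i)       = compl-∘ (ρ i)
map-ren-resp-≈ ρ (idem-pos i)      = idem-pos (ρ i)
map-ren-resp-≈ ρ (idem-neg i)      = idem-neg (ρ i)

map-term-inverseˡ : ∀ {A B : Set} {g : A → B} {h : B → A} →
  (∀ a → h (g a) ≡ a) → ∀ s → map-term h (map-term g s) ≡ s
map-term-inverseˡ h∘g≗id (var a) = cong var (h∘g≗id a)
map-term-inverseˡ h∘g≗id θ       = refl
map-term-inverseˡ h∘g≗id one     = refl
map-term-inverseˡ h∘g≗id (s ∘ t) =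
  cong₂ _∘_ (map-term-inverseˡ h∘g≗id s) (map-term-inverseˡ h∘g≗id t)
map-term-inverseˡ h∘g≗id (s · t) =
  cong₂ _·_ (map-term-inverseˡ h∘g≗id s) (map-term-inverseˡ h∘g≗id t)

reduce : ∀ {M} N .{{_ : NonZero N}} → Fin M → Fin N
reduce N j = toℕ j mod N

reduce-inject≤ : ∀ {N M} .{{_ : NonZero N}} (N≤M : N ≤ M) (i : Fin N) →
  reduce N (inject≤ i N≤M) ≡ i
reduce-inject≤ {N} N≤M i = toℕ-injective (begin
  toℕ (reduce N (inject≤ i N≤M)) ≡⟨ toℕ-fromℕ< _ ⟩
  toℕ (inject≤ i N≤M) % N        ≡⟨ cong (_% N) (toℕ-inject≤ i N≤M) ⟩
  toℕ i % N                      ≡⟨ m<n⇒m%n≡m (toℕ<n i) ⟩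
  toℕ i                          ∎)
  where open ≡-Reasoning

ren-reduce-inc-gen : ∀ {N M} .{{_ : NonZero N}} (N≤M : N ≤ M) (a : Gen N) →
  ren (reduce N) (inc-gen N≤M a) ≡ a
ren-reduce-inc-gen N≤M (pos i) = cong pos (reduce-inject≤ N≤M i)
ren-reduce-inc-gen N≤M (neg i) = cong neg (reduce-inject≤ N≤M i)

proposition3p1 : (N M : ℕ) → 0 < N → (N≤M : N ≤ M) →
    (s t : Term (Gen N)) → f N≤M s ≈ f N≤M t → s ≈ t
proposition3p1 N M 0<N N≤M s t fs≈ft =
  subst₂ _≈_ (retraction s) (retraction t) (map-ren-resp-≈ (reduce N) fs≈ft)
  where
  instance
    N≢0 : NonZero N
    N≢0 = >-nonZero 0<N

  retraction : ∀ u → map-term (ren (reduce N)) (f N≤M u) ≡ u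
  retraction = map-term-inverseˡ (ren-reduce-inc-gen N≤M)
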